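{- Let $m,n\ge1$ and let $[P',Q']$ be an interval of $\mathbb{D}'_{m,n}$. Delete in $P'$ and $Q'$ the first large peak $U^mD^m$ (i.e. if $P'=U^cD^mB$ with $U^c$ its first ascent, replace it by $U^{c-m}B$, and similarly for $Q'$), obtaining $P,Q\in\mathbb{D}'_{m,n-1}$. Then $P\le Q$. Conversely, let $[P,Q]$ be an interval of $\mathbb{D}'_{m,n-1}$ with ascent compositions $c(P)=(c_1,c_2,\dots)$ and $c(Q)=(d_1,d_2,\dots)$, and let $r=r(P,Q)$. Insert a large peak $U^mD^m$ into the first ascent of $P$ at height $a'\in\{0,\dots,c_1\}$ (i.e. $P=U^{c_1}B$ becomes $U^{a'}U^mD^mU^{c_1-a'}B$) and into the first ascent of $Q$ at height $b'\in\{0,\dots,d_1\}$, obtaining $P',Q'$. Then $P'\le Q'$ if and only if either $b'\in\{c_1,c_1+c_2,\dots,c_1+\cdots+c_r=d_1\}$ and $a'$ is arbitrary in $\{0,\dots,c_1\}$, or $0\le a'=b'<c_1$.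
   Context: Dyck paths of size $N$: lattice paths from $(0,0)$ with $N$ steps $U=(1,1)$ and $N$ steps $D=(1,-1)$, ending on the $x$-axis, never below it. An ascent (resp. descent) is a maximal run of up (resp. down) steps; the ascent composition $c(P)$ lists the ascent lengths of $P$ from left to right. $\mathbb{D}_N$: Dyck paths of size $N$ ordered by the reflexive-transitive closure of replacing a factor $DU^kD$ ($k\ge1$) by $U^kDD$; if $P\le Q$ then $c(P)$ refines $c(Q)$. $\mathbb{D}'_{m,n}$: Dyck paths of size $mn$ whose descent lengths are all multiples of $m$, with the order induced from $\mathbb{D}_{mn}$. For $P\le Q$ with $c(P)=(c_1,c_2,\dots)$, $c(Q)=(d_1,\dots)$, $r(P,Q)$ is the unique integer $r$ with $c_1+\cdots+c_r=d_1$. -}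

module Defs where

open import Data.Nat using (ℕ; zero; suc; _+_; _*_; _∸_; _≤_; _<_)
open import Data.Nat.Divisibility using (_∣_)
open import Data.List using (List; []; _∷_; _++_; replicate; length; drop; take)
open import Data.Nat.ListAction using (sum)
open import Data.List.Relation.Unary.All using (All)
open import Data.Product using (_×_)
open import Relation.Binary.PropositionalEquality using (_≡_)
open import Relation.Binary.Construct.Closure.ReflexiveTransitive using (Star)

data Step : Set where
  U D : Step

Path : Set
Path = List Step

data DyckFrom : ℕ → Path → Set where
  done : DyckFrom 0 []
  up   : ∀ {h p} → DyckFrom (suc h) p → DyckFrom h (U ∷ p)
  down : ∀ {h p} → DyckFrom h p → DyckFrom (suc h) (D ∷ p)

Dyck : ℕ → Path → Set
Dyck N p = DyckFrom 0 p × length p ≡ N + N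

flush : ℕ → List ℕ
flush zero    = []
flush (suc k) = suc k ∷ []

-- lengths of the maximal runs of U, resp. D, (k = length of current run)
ascentsAux : ℕ → Path → List ℕ
ascentsAux k []       = flush k
ascentsAux k (U ∷ p) = ascentsAux (suc k) p
ascentsAux k (D ∷ p) = flush k ++ ascentsAux 0 p

descentsAux : ℕ → Path → List ℕ
descentsAux k []       = flush k
descentsAux k (D ∷ p) = descentsAux (suc k) p
descentsAux k (U ∷ p) = flush k ++ descentsAux 0 p

ascents : Path → List ℕ
ascents = ascentsAux 0

descents : Path → List ℕ
descents = descentsAux 0

c₁ : Path → ℕ
c₁ p with ascents p
... | []    = 0
... | c ∷ _ = c

D' : ℕ → ℕ → Path → Set
D' m n p = Dyck (m * n) p × All (m ∣_) (descents p)

data Move : Path → Path → Set where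
  move : ∀ (A B : Path) (k : ℕ) → 1 ≤ k →
         Move (A ++ D ∷ replicate k U ++ D ∷ B) (A ++ replicate k U ++ D ∷ D ∷ B)

-- the order: reflexive-transitive closure of Move
-- (moves preserve Dyck paths, so this is the order of 𝔻_N, and of 𝔻'_{m,n} by restriction)
infix 4 _≤ₚ_
_≤ₚ_ : Path → Path → Set
_≤ₚ_ = Star Move

deletePeak : ℕ → Path → Path
deletePeak m p = replicate (c₁ p ∸ m) U ++ drop (c₁ p + m) p

-- insert a large peak at height a into the first ascent:
-- U^(c₁) B ↦ U^a U^m D^m U^(c₁-a) B   (used with a ≤ c₁)
insertPeak : ℕ → ℕ → Path → Path
insertPeak m a p = replicate a U ++ replicate m U ++ replicate m D ++ drop a p

psum : ℕ → List ℕ → ℕ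
psum j c = sum (take j c)

-- A path is encoded by its up-count sequence: for every D step, the number of U steps before it.
-- A move D U^k D ↦ U^k D D raises one entry of this weakly increasing sequence to the value of
-- its successor, and conversely such raises can always be realised by moves.  Hence, for Dyck
-- paths, P ≤ Q holds iff the sequences u, v of P, Q satisfy u ⊑ v: every v_i occurs among
-- u_i, u_{i+1}, ….  Inserting the peak U^m D^m at height a into the first ascent replaces u by m
-- copies of a + m followed by u shifted by m.  So the paths with peaks inserted at heights a and
-- b compare iff u ⊑ v and b + m is a + m or a shifted entry of u, i.e. b = a or b ∈ u.  The
-- entries of u are the partial sums c_1 + ⋯ + c_j of the ascent composition, and b ≤ d_1 =
-- c_1 + ⋯ + c_r lets one take j ≤ r.  Deleting the first large peak is the inverse operation,
-- available because the first descent of a path of 𝔻'_{m,n+1} is a positive multiple of m.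

module Submission where

open import Defs
open import Data.Nat using (ℕ; zero; suc; _+_; _*_; _∸_; _≤_; _<_; _⊔_; z≤n; s≤s; _≤?_)
open import Data.Nat.Properties
open import Data.Nat.Divisibility using (_∣_; ∣m+n∣m⇒∣n; ∣-refl; ∣⇒≤)
open import Data.Nat.Tactic.RingSolver using (solve-∀)
open import Data.List using (List; []; _∷_; _++_; replicate; length; drop; map)
open import Data.List.Properties using (++-assoc; length-++; length-replicate; drop-drop)
open import Data.List.Membership.Propositional using (_∈_)
open import Data.List.Membership.Propositional.Properties using (∈-map⁺; ∈-map⁻; ∈-++⁺ʳ)
open import Data.List.Relation.Unary.Any using (here; there)
open import Data.List.Relation.Unary.All as All using (All; []; _∷_)
open import Data.List.Relation.Unary.All.Properties using (++⁺; ++⁻ˡ; ++⁻ʳ)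
open import Data.Product using (_×_; _,_; proj₁; proj₂; ∃; ∃₂; ∃-syntax)
open import Data.Product.Function.NonDependent.Propositional using (_×-⇔_)
open import Data.Sum using (_⊎_; inj₁; inj₂; [_,_]′)
open import Data.Sum.Function.Propositional using (_⊎-⇔_)
open import Data.Empty using (⊥-elim)
open import Function.Base using (_∘_)
open import Function.Bundles using (_⇔_; mk⇔; Equivalence)
open import Function.Definitions using (Injective)
open import Function.Properties.Equivalence using () renaming (trans to ⇔-trans)
open import Relation.Nullary using (yes; no)
open import Relation.Binary.PropositionalEquality
open import Relation.Binary.Construct.Closure.ReflexiveTransitive using (Star; ε; _◅_; _◅◅_; gmap)

replicate-+-++ : ∀ {A : Set} j k (x : A) l → replicate (j + k) x ++ l ≡ replicate j x ++ replicate k x ++ l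
replicate-+-++ zero    k x l = refl
replicate-+-++ (suc j) k x l = cong (x ∷_) (replicate-+-++ j k x l)

drop-replicate-++ : ∀ {A : Set} j (x : A) l → drop j (replicate j x ++ l) ≡ l
drop-replicate-++ zero    x l = refl
drop-replicate-++ (suc j) x l = drop-replicate-++ j x l

length-replicate-++ : ∀ {A : Set} j (x : A) l → length (replicate j x ++ l) ≡ j + length l
length-replicate-++ j x l = trans (length-++ (replicate j x)) (cong (_+ length l) (length-replicate j))

-- Peaks in Dyck paths

withPeak : ℕ → ℕ → Path → Path
withPeak m e Y = replicate e U ++ replicate m U ++ replicate m D ++ Y

DyckFrom-U^⁺ : ∀ k {h q} → DyckFrom (k + h) q → DyckFrom h (replicate k U ++ q)
DyckFrom-U^⁺ zero    d = d
DyckFrom-U^⁺ (suc k) {h} {q} d = up (DyckFrom-U^⁺ k (subst (λ i → DyckFrom i q) (sym (+-suc k h)) d))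

DyckFrom-U^⁻ : ∀ k {h q} → DyckFrom h (replicate k U ++ q) → DyckFrom (k + h) q
DyckFrom-U^⁻ zero    d = d
DyckFrom-U^⁻ (suc k) {h} {q} (up d) = subst (λ i → DyckFrom i q) (+-suc k h) (DyckFrom-U^⁻ k d)

DyckFrom-D^⁺ : ∀ k {h q} → DyckFrom h q → DyckFrom (k + h) (replicate k D ++ q)
DyckFrom-D^⁺ zero    d = d
DyckFrom-D^⁺ (suc k) d = down (DyckFrom-D^⁺ k d)

DyckFrom-D^⁻ : ∀ k {h q} → DyckFrom (k + h) (replicate k D ++ q) → DyckFrom h q
DyckFrom-D^⁻ zero    d        = d
DyckFrom-D^⁻ (suc k) (down d) = DyckFrom-D^⁻ k d

DyckFrom-D^-≤ : ∀ k {h q} → DyckFrom h (replicate k D ++ q) → k ≤ h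
DyckFrom-D^-≤ zero    d        = z≤n
DyckFrom-D^-≤ (suc k) (down d) = s≤s (DyckFrom-D^-≤ k d)

DyckFrom-withPeak⇔ : ∀ m e {h Y} → DyckFrom h (withPeak m e Y) ⇔ DyckFrom h (replicate e U ++ Y)
DyckFrom-withPeak⇔ m e = mk⇔
  (λ d → DyckFrom-U^⁺ e (DyckFrom-D^⁻ m (DyckFrom-U^⁻ m (DyckFrom-U^⁻ e d))))
  (λ d → DyckFrom-U^⁺ e (DyckFrom-U^⁺ m (DyckFrom-D^⁺ m (DyckFrom-U^⁻ e d))))

leadU : Path → ℕ
leadU (U ∷ p) = suc (leadU p)
leadU _       = 0

leadU-U^ : ∀ j p → leadU (replicate j U ++ p) ≡ j + leadU p
leadU-U^ zero    p = refl
leadU-U^ (suc j) p = cong suc (leadU-U^ j p)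

replicate-leadU : ∀ a p → a ≤ leadU p → replicate a U ++ drop a p ≡ p
replicate-leadU zero    p       _         = refl
replicate-leadU (suc a) (U ∷ p) (s≤s a≤) = cong (U ∷_) (replicate-leadU a p a≤)

DyckFrom-insertPeak : ∀ m {a h P} → a ≤ leadU P → DyckFrom h P → DyckFrom h (insertPeak m a P)
DyckFrom-insertPeak m {a} {P = P} a≤ d =
  Equivalence.from (DyckFrom-withPeak⇔ m a) (subst (DyckFrom _) (sym (replicate-leadU a P a≤)) d)

ascentsAux-suc : ∀ k p → ∃ λ cs → ascentsAux (suc k) p ≡ (leadU p + suc k) ∷ cs
ascentsAux-suc k []      = [] , refl
ascentsAux-suc k (U ∷ p) with ascentsAux-suc (suc k) p
... | cs , eq = cs , trans eq (cong (_∷ cs) (+-suc (leadU p) (suc k)))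
ascentsAux-suc k (D ∷ p) = ascentsAux 0 p , refl

c₁-∷ : ∀ p {c cs} → ascents p ≡ c ∷ cs → c₁ p ≡ c
c₁-∷ p eq rewrite eq = refl

c₁≡leadU : ∀ {p} → DyckFrom 0 p → c₁ p ≡ leadU p
c₁≡leadU done           = refl
c₁≡leadU {U ∷ p} (up _) = trans (c₁-∷ (U ∷ p) (proj₂ (ascentsAux-suc 0 p))) (+-comm (leadU p) 1)

drop-withPeak : ∀ m e Y → drop (e + m + m) (withPeak m e Y) ≡ Y
drop-withPeak m e Y = begin
  drop (e + m + m) (withPeak m e Y)                      ≡⟨ sym (drop-drop (e + m) m _) ⟩
  drop m (drop (e + m) (withPeak m e Y))                 ≡⟨ cong (drop m) (sym (drop-drop e m _)) ⟩
  drop m (drop m (drop e (withPeak m e Y)))              ≡⟨ cong (drop m ∘ drop m) (drop-replicate-++ e U _) ⟩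
  drop m (drop m (replicate m U ++ replicate m D ++ Y))  ≡⟨ cong (drop m) (drop-replicate-++ m U _) ⟩
  drop m (replicate m D ++ Y)                            ≡⟨ drop-replicate-++ m D Y ⟩
  Y                                                      ∎
  where open ≡-Reasoning

c₁-withPeak : ∀ m e Y → DyckFrom 0 (withPeak (suc m) e Y) → c₁ (withPeak (suc m) e Y) ≡ e + suc m
c₁-withPeak m e Y d = begin
  c₁ (withPeak (suc m) e Y)                                    ≡⟨ c₁≡leadU d ⟩
  leadU (withPeak (suc m) e Y)                                 ≡⟨ leadU-U^ e _ ⟩
  e + leadU (replicate (suc m) U ++ replicate (suc m) D ++ Y)  ≡⟨ cong (e +_) (leadU-U^ (suc m) _) ⟩
  e + (suc m + 0)                                              ≡⟨ cong (e +_) (+-identityʳ (suc m)) ⟩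
  e + suc m                                                    ∎
  where open ≡-Reasoning

deletePeak-withPeak : ∀ m e Y → DyckFrom 0 (withPeak (suc m) e Y) →
                      deletePeak (suc m) (withPeak (suc m) e Y) ≡ replicate e U ++ Y
deletePeak-withPeak m e Y d rewrite c₁-withPeak m e Y d =
  cong₂ _++_ (cong (λ j → replicate j U) (m+n∸n≡m e (suc m))) (drop-withPeak (suc m) e Y)

descentsAux-U^ : ∀ j q → descentsAux 0 (replicate j U ++ q) ≡ descentsAux 0 q
descentsAux-U^ zero    q = refl
descentsAux-U^ (suc j) q = descentsAux-U^ j q

descentsAux-D^ : ∀ j k q → descentsAux k (replicate j D ++ q) ≡ descentsAux (j + k) q
descentsAux-D^ zero    k q = refl
descentsAux-D^ (suc j) k q = trans (descentsAux-D^ j (suc k) q) (cong (λ i → descentsAux i q) (+-suc j k))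

flush-∣-+⁻ : ∀ m k → All (m ∣_) (flush (m + k)) → All (m ∣_) (flush k)
flush-∣-+⁻ m zero    _ = []
flush-∣-+⁻ m (suc k) m∣ rewrite +-suc m k with m∣
... | m∣m+k ∷ [] = ∣m+n∣m⇒∣n (subst (m ∣_) (sym (+-suc m k)) m∣m+k) ∣-refl ∷ []

descentsAux-∣-+⁻ : ∀ m k q → All (m ∣_) (descentsAux (m + k) q) → All (m ∣_) (descentsAux k q)
descentsAux-∣-+⁻ m k []      m∣ = flush-∣-+⁻ m k m∣
descentsAux-∣-+⁻ m k (D ∷ q) m∣ =
  descentsAux-∣-+⁻ m (suc k) q (subst (λ i → All (m ∣_) (descentsAux i q)) (sym (+-suc m k)) m∣)
descentsAux-∣-+⁻ m k (U ∷ q) m∣ =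
  ++⁺ (flush-∣-+⁻ m k (++⁻ˡ (flush (m + k)) m∣)) (++⁻ʳ (flush (m + k)) m∣)

descent-continues : ∀ {m} j k q → suc k + j ≤ m → All (m ∣_) (descentsAux (suc k) q) →
                    ∃ λ Y → q ≡ replicate j D ++ Y
descent-continues zero    k q       _  _ = q , refl
descent-continues {m} (suc j) k (D ∷ q) le m∣
  with descent-continues j (suc k) q (subst (_≤ m) (+-suc (suc k) j) le) m∣
... | Y , refl = Y , refl
descent-continues (suc j) k []      le (m∣ ∷ []) = ⊥-elim (m+1+n≰m (suc k) (≤-trans le (∣⇒≤ m∣)))
descent-continues (suc j) k (U ∷ q) le (m∣ ∷ _)  = ⊥-elim (m+1+n≰m (suc k) (≤-trans le (∣⇒≤ m∣)))

firstDescent : ∀ m {c} p → DyckFrom (suc c) p → All (suc m ∣_) (descentsAux 0 p) →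
               ∃₂ λ e Y → p ≡ replicate e U ++ replicate (suc m) D ++ Y
firstDescent m (U ∷ p) (up d) m∣ with firstDescent m p d m∣
... | e , Y , refl = suc e , Y , refl
firstDescent m (D ∷ p) (down d) m∣ with descent-continues m 0 p ≤-refl m∣
... | Y , refl = 0 , Y , refl

withPeak-view : ∀ {m n p} → D' (suc m) (suc n) p → ∃₂ λ e Y → p ≡ withPeak (suc m) e Y
withPeak-view {p = []} ((_ , ()) , _)
withPeak-view {m} {p = U ∷ p} ((up d , _) , m∣) with firstDescent m p d m∣
... | e , Y , refl = e ∸ m , Y , split
  where
  m≤e : suc m ≤ suc e
  m≤e = subst (suc m ≤_) (+-identityʳ (suc e))
          (DyckFrom-D^-≤ (suc m) (DyckFrom-U^⁻ (suc e) {q = replicate (suc m) D ++ Y} (up d)))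
  split : replicate (suc e) U ++ replicate (suc m) D ++ Y ≡ withPeak (suc m) (e ∸ m) Y
  split = trans (cong (λ i → replicate i U ++ replicate (suc m) D ++ Y) (sym (m∸n+n≡m m≤e)))
                (replicate-+-++ (e ∸ m) (suc m) U _)

length-withPeak : ∀ m e Y → length (withPeak m e Y) ≡ length (replicate e U ++ Y) + (m + m)
length-withPeak m e Y
  rewrite length-replicate-++ e U (replicate m U ++ replicate m D ++ Y)
        | length-replicate-++ m U (replicate m D ++ Y)
        | length-replicate-++ m D Y
        | length-replicate-++ e U Y = shuffle e m (length Y)
  where
  shuffle : ∀ e m l → e + (m + (m + l)) ≡ e + l + (m + m)
  shuffle = solve-∀

descents-withPeak : ∀ m e Y → descents (withPeak m e Y) ≡ descentsAux (m + 0) Y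
descents-withPeak m e Y = trans (descentsAux-U^ e _) (trans (descentsAux-U^ m _) (descentsAux-D^ m 0 Y))

D'-withPeak⁻ : ∀ m n e Y → D' m (suc n) (withPeak m e Y) → D' m n (replicate e U ++ Y)
D'-withPeak⁻ m n e Y ((d , len) , m∣) = (Equivalence.to (DyckFrom-withPeak⇔ m e) d , len⁻) , m∣⁻
  where
  sizes : ∀ m n → m * suc n + m * suc n ≡ m * n + m * n + (m + m)
  sizes = solve-∀
  len⁻ : length (replicate e U ++ Y) ≡ m * n + m * n
  len⁻ = +-cancelʳ-≡ (m + m) _ _ (trans (sym (length-withPeak m e Y)) (trans len (sizes m n)))
  m∣⁻ : All (m ∣_) (descents (replicate e U ++ Y))
  m∣⁻ = subst (All (m ∣_)) (sym (descentsAux-U^ e Y))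
          (descentsAux-∣-+⁻ m 0 Y (subst (All (m ∣_)) (descents-withPeak m e Y) m∣))

-- Up-count sequences

upCounts : ℕ → Path → List ℕ
upCounts k []      = []
upCounts k (U ∷ p) = upCounts (suc k) p
upCounts k (D ∷ p) = k ∷ upCounts k p

upCounts-U^ : ∀ j k p → upCounts k (replicate j U ++ p) ≡ upCounts (k + j) p
upCounts-U^ zero    k p = cong (λ i → upCounts i p) (sym (+-identityʳ k))
upCounts-U^ (suc j) k p = trans (upCounts-U^ j (suc k) p) (cong (λ i → upCounts i p) (sym (+-suc k j)))

upCounts-D^ : ∀ j k p → upCounts k (replicate j D ++ p) ≡ replicate j k ++ upCounts k p
upCounts-D^ zero    k p = refl
upCounts-D^ (suc j) k p = cong (k ∷_) (upCounts-D^ j k p)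

upCounts-+ : ∀ j k p → upCounts (k + j) p ≡ map (_+ j) (upCounts k p)
upCounts-+ j k []      = refl
upCounts-+ j k (U ∷ p) = upCounts-+ j (suc k) p
upCounts-+ j k (D ∷ p) = cong (k + j ∷_) (upCounts-+ j k p)

upCounts-withPeak : ∀ m e k Y → upCounts k (withPeak m e Y)
                    ≡ replicate m (k + e + m) ++ map (_+ m) (upCounts k (replicate e U ++ Y))
upCounts-withPeak m e k Y = begin
  upCounts k (withPeak m e Y)                                 ≡⟨ upCounts-U^ e k _ ⟩
  upCounts (k + e) (replicate m U ++ replicate m D ++ Y)      ≡⟨ upCounts-U^ m (k + e) _ ⟩
  upCounts (k + e + m) (replicate m D ++ Y)                   ≡⟨ upCounts-D^ m (k + e + m) Y ⟩
  replicate m (k + e + m) ++ upCounts (k + e + m) Y           ≡⟨ cong (replicate m (k + e + m) ++_) (upCounts-+ m (k + e) Y) ⟩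
  replicate m (k + e + m) ++ map (_+ m) (upCounts (k + e) Y)  ≡⟨ cong (λ u → replicate m (k + e + m) ++ map (_+ m) u) (sym (upCounts-U^ e k Y)) ⟩
  replicate m (k + e + m) ++ map (_+ m) (upCounts k (replicate e U ++ Y)) ∎
  where open ≡-Reasoning

upCounts-insertPeak : ∀ m a P → a ≤ leadU P →
                      upCounts 0 (insertPeak m a P) ≡ replicate m (a + m) ++ map (_+ m) (upCounts 0 P)
upCounts-insertPeak m a P a≤ = trans (upCounts-withPeak m a 0 (drop a P))
  (cong (λ p → replicate m (a + m) ++ map (_+ m) (upCounts 0 p)) (replicate-leadU a P a≤))

data SortedFrom (b : ℕ) : List ℕ → Set where
  []  : SortedFrom b []
  _∷_ : ∀ {x xs} → b ≤ x → SortedFrom x xs → SortedFrom b (x ∷ xs)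

SortedFrom-weaken : ∀ {a b xs} → a ≤ b → SortedFrom b xs → SortedFrom a xs
SortedFrom-weaken a≤b []          = []
SortedFrom-weaken a≤b (b≤x ∷ s) = ≤-trans a≤b b≤x ∷ s

SortedFrom-∈ : ∀ {b xs y} → SortedFrom b xs → y ∈ xs → b ≤ y
SortedFrom-∈ (b≤x ∷ s) (here refl) = b≤x
SortedFrom-∈ (b≤x ∷ s) (there y∈)  = ≤-trans b≤x (SortedFrom-∈ s y∈)

SortedFrom-map : ∀ {f : ℕ → ℕ} → (∀ {x y} → x ≤ y → f x ≤ f y) →
                 ∀ {b xs} → SortedFrom b xs → SortedFrom (f b) (map f xs)
SortedFrom-map mono []          = []
SortedFrom-map mono (b≤x ∷ s) = mono b≤x ∷ SortedFrom-map mono s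

map-⊔-SortedFrom : ∀ {b xs} → SortedFrom b xs → map (b ⊔_) xs ≡ xs
map-⊔-SortedFrom []          = refl
map-⊔-SortedFrom (b≤x ∷ s) = cong₂ _∷_ (m≤n⇒m⊔n≡n b≤x) (map-⊔-SortedFrom (SortedFrom-weaken b≤x s))

upCounts-sorted : ∀ k p → SortedFrom k (upCounts k p)
upCounts-sorted k []      = []
upCounts-sorted k (U ∷ p) = SortedFrom-weaken (n≤1+n k) (upCounts-sorted (suc k) p)
upCounts-sorted k (D ∷ p) = ≤-refl ∷ upCounts-sorted k p

-- The order on up-count sequences

infix 4 _⊑_
data _⊑_ : List ℕ → List ℕ → Set where
  []  : [] ⊑ []
  _∷_ : ∀ {x y u v} → y ∈ x ∷ u → u ⊑ v → x ∷ u ⊑ y ∷ v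

⊑-refl : ∀ u → u ⊑ u
⊑-refl []      = []
⊑-refl (x ∷ u) = here refl ∷ ⊑-refl u

⊑-∈ : ∀ {u v y} → u ⊑ v → y ∈ v → y ∈ u
⊑-∈ (y∈ ∷ _)   (here refl)  = y∈
⊑-∈ (_ ∷ u⊑v) (there y∈v) = there (⊑-∈ u⊑v y∈v)

⊑-trans : ∀ {u v w} → u ⊑ v → v ⊑ w → u ⊑ w
⊑-trans []              []            = []
⊑-trans u⊑v@(_ ∷ u⊑v′) (z∈ ∷ v⊑w′) = ⊑-∈ u⊑v z∈ ∷ ⊑-trans u⊑v′ v⊑w′

∈-replicate-++⁻ : ∀ k {x y : ℕ} {u} → y ∈ replicate k x ++ u → y ≡ x ⊎ y ∈ u
∈-replicate-++⁻ zero    y∈          = inj₂ y∈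
∈-replicate-++⁻ (suc k) (here y≡x)  = inj₁ y≡x
∈-replicate-++⁻ (suc k) (there y∈)  = ∈-replicate-++⁻ k y∈

replicate-++-⊑⁺ : ∀ k {x y u v} → y ≡ x ⊎ y ∈ u → u ⊑ v → replicate k x ++ u ⊑ replicate k y ++ v
replicate-++-⊑⁺ zero    _  u⊑v = u⊑v
replicate-++-⊑⁺ (suc k) {x} y∈ u⊑v =
  [ here , there ∘ ∈-++⁺ʳ (replicate k x) ]′ y∈ ∷ replicate-++-⊑⁺ k y∈ u⊑v

replicate-++-⊑⁻ : ∀ k {x y u v} → replicate k x ++ u ⊑ replicate k y ++ v → u ⊑ v
replicate-++-⊑⁻ zero    u⊑v       = u⊑v
replicate-++-⊑⁻ (suc k) (_ ∷ u⊑v) = replicate-++-⊑⁻ k u⊑v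

map⁺-⊑ : ∀ f {u v} → u ⊑ v → map f u ⊑ map f v
map⁺-⊑ f []          = []
map⁺-⊑ f (y∈ ∷ u⊑v) = ∈-map⁺ f y∈ ∷ map⁺-⊑ f u⊑v

∈-map⁻-injective : ∀ {f : ℕ → ℕ} → Injective _≡_ _≡_ f → ∀ {x xs} → f x ∈ map f xs → x ∈ xs
∈-map⁻-injective {f} inj fx∈ with ∈-map⁻ f fx∈
... | _ , y∈ , fx≡fy = subst (_∈ _) (sym (inj fx≡fy)) y∈

map⁻-⊑ : ∀ {f} → Injective _≡_ _≡_ f → ∀ {u v} → map f u ⊑ map f v → u ⊑ v
map⁻-⊑ inj {[]}    {[]}    []          = []
map⁻-⊑ inj {_ ∷ _} {_ ∷ _} (y∈ ∷ u⊑v) = ∈-map⁻-injective inj y∈ ∷ map⁻-⊑ inj u⊑v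

replicate-++-⊑⇔ : ∀ k {x y u v} →
                  replicate (suc k) x ++ u ⊑ replicate (suc k) y ++ v ⇔ ((y ≡ x ⊎ y ∈ u) × u ⊑ v)
replicate-++-⊑⇔ k = mk⇔
  (λ { le@(y∈ ∷ _) → ∈-replicate-++⁻ (suc k) y∈ , replicate-++-⊑⁻ (suc k) le })
  (λ (y∈ , u⊑v) → replicate-++-⊑⁺ (suc k) y∈ u⊑v)

∈-map⇔ : ∀ {f : ℕ → ℕ} → Injective _≡_ _≡_ f → ∀ {x xs} → f x ∈ map f xs ⇔ x ∈ xs
∈-map⇔ {f} inj = mk⇔ (∈-map⁻-injective inj) (∈-map⁺ f)

map-⊑⇔ : ∀ {f} → Injective _≡_ _≡_ f → ∀ {u v} → map f u ⊑ map f v ⇔ u ⊑ v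
map-⊑⇔ {f} inj = mk⇔ (map⁻-⊑ inj) (map⁺-⊑ f)

replicate-map-⊑⇔ : ∀ {f} → Injective _≡_ _≡_ f → ∀ k {a b u v} →
                   replicate (suc k) (f a) ++ map f u ⊑ replicate (suc k) (f b) ++ map f v
                   ⇔ ((b ≡ a ⊎ b ∈ u) × u ⊑ v)
replicate-map-⊑⇔ {f} inj k =
  ⇔-trans (replicate-++-⊑⇔ k) ((mk⇔ inj (cong f) ⊎-⇔ ∈-map⇔ inj) ×-⇔ map-⊑⇔ inj)

peak-⊑⇔ : ∀ m {a b u v} →
          replicate (suc m) (a + suc m) ++ map (_+ suc m) u ⊑ replicate (suc m) (b + suc m) ++ map (_+ suc m) v
          ⇔ ((b ≡ a ⊎ b ∈ u) × u ⊑ v)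
peak-⊑⇔ m = replicate-map-⊑⇔ (λ {x} {y} → +-cancelʳ-≡ (suc m) x y) m

Move⇒⊑ : ∀ k {p q} → Move p q → upCounts k p ⊑ upCounts k q
Move⇒⊑ k (move A B i _) = go A k
  where
  go : ∀ A k → upCounts k (A ++ D ∷ replicate i U ++ D ∷ B) ⊑ upCounts k (A ++ replicate i U ++ D ∷ D ∷ B)
  go []      k rewrite upCounts-U^ i k (D ∷ B) | upCounts-U^ i k (D ∷ D ∷ B) =
    there (here refl) ∷ here refl ∷ ⊑-refl _
  go (U ∷ A) k = go A (suc k)
  go (D ∷ A) k = here refl ∷ go A k

≤ₚ⇒⊑ : ∀ k {p q} → p ≤ₚ q → upCounts k p ⊑ upCounts k q
≤ₚ⇒⊑ k ε        = ⊑-refl _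
≤ₚ⇒⊑ k (m ◅ ms) = ⊑-trans (Move⇒⊑ k m) (≤ₚ⇒⊑ k ms)

⊔-⊑ : ∀ {y u v} → SortedFrom y v → u ⊑ v → map (y ⊔_) u ⊑ v
⊔-⊑ []          []          = []
⊔-⊑ {y} (y≤z ∷ s) (z∈ ∷ u⊑v) =
  subst (_∈ _) (m≤n⇒m⊔n≡n y≤z) (∈-map⁺ (y ⊔_) z∈) ∷ ⊔-⊑ (SortedFrom-weaken y≤z s) u⊑v

infix 4 _↗_ _↗*_
data _↗_ : List ℕ → List ℕ → Set where
  here  : ∀ {x y ys} → x < y → x ∷ y ∷ ys ↗ y ∷ y ∷ ys
  there : ∀ {z u v} → u ↗ v → z ∷ u ↗ z ∷ v

_↗*_ : List ℕ → List ℕ → Set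
_↗*_ = Star _↗_

↗-SortedFrom : ∀ {b u v} → u ↗ v → SortedFrom b u → SortedFrom b v
↗-SortedFrom (here x<y) (b≤x ∷ x≤y ∷ s) = ≤-trans b≤x x≤y ∷ ≤-refl ∷ s
↗-SortedFrom (there r)  (b≤z ∷ s)         = b≤z ∷ ↗-SortedFrom r s

∷⁺-↗* : ∀ {z u v} → u ↗* v → z ∷ u ↗* z ∷ v
∷⁺-↗* = gmap (_ ∷_) there

-- The entries up to the occurrence of y are raised to y, from right to left.
raise : ∀ {b x y u} → SortedFrom b (x ∷ u) → y ∈ x ∷ u → x ∷ u ↗* y ∷ map (y ⊔_) u
raise {x = x} {u = u} (_ ∷ s) (here refl) = subst (λ w → x ∷ u ↗* x ∷ w) (sym (map-⊔-SortedFrom s)) ε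
raise {x = x} {y} {z ∷ w} (_ ∷ s@(x≤z ∷ s′)) (there y∈) = ∷⁺-↗* (raise s y∈) ◅◅ step
  where
  z≤y : z ≤ y
  z≤y = SortedFrom-∈ (≤-refl ∷ s′) y∈
  step : x ∷ y ∷ map (y ⊔_) w ↗* y ∷ (y ⊔ z) ∷ map (y ⊔_) w
  step rewrite m≥n⇒m⊔n≡m z≤y with m≤n⇒m<n∨m≡n (≤-trans x≤z z≤y)
  ... | inj₁ x<y  = here x<y ◅ ε
  ... | inj₂ refl = ε

⊑⇒↗* : ∀ {a b u v} → SortedFrom a u → SortedFrom b v → u ⊑ v → u ↗* v
⊑⇒↗* []            []          []           = ε
⊑⇒↗* su@(_ ∷ sx) (_ ∷ sv) (_∷_ {x} {y} y∈ u⊑v) =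
  raise su y∈ ◅◅ ∷⁺-↗* (⊑⇒↗* sorted sv (⊔-⊑ sv u⊑v))
  where
  sorted : SortedFrom y (map (y ⊔_) _)
  sorted = SortedFrom-weaken (m≤m⊔n y x) (SortedFrom-map (⊔-monoʳ-≤ y) sx)

fromUpCounts : ℕ → List ℕ → Path
fromUpCounts k []       = []
fromUpCounts k (x ∷ xs) = replicate (x ∸ k) U ++ D ∷ fromUpCounts x xs

-- Decoding loses trailing U steps; j ≤ h rules them out.
fromUpCounts-upCounts : ∀ j k {h p} → DyckFrom h p → j ≤ h →
                        fromUpCounts k (upCounts (j + k) p) ≡ replicate j U ++ p
fromUpCounts-upCounts zero    k done z≤n = refl
fromUpCounts-upCounts j       k {p = U ∷ p} (up d) j≤h = begin
  fromUpCounts k (upCounts (suc j + k) p)  ≡⟨ fromUpCounts-upCounts (suc j) k d (s≤s j≤h) ⟩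
  replicate (suc j) U ++ p                 ≡⟨ cong (λ i → replicate i U ++ p) (+-comm 1 j) ⟩
  replicate (j + 1) U ++ p                 ≡⟨ replicate-+-++ j 1 U p ⟩
  replicate j U ++ U ∷ p                   ∎
  where open ≡-Reasoning
fromUpCounts-upCounts j       k {p = D ∷ p} (down d) _ =
  cong₂ (λ i q → replicate i U ++ D ∷ q) (m+n∸n≡m j k) (fromUpCounts-upCounts 0 (j + k) d z≤n)

Move-prefix : ∀ W {p q} → Move p q → Move (W ++ p) (W ++ q)
Move-prefix W (move A B k k≥1) =
  subst₂ Move (++-assoc W A _) (++-assoc W A _) (move (W ++ A) B k k≥1)

↗⇒Move : ∀ {b u v} → u ↗ v → SortedFrom b u → Move (fromUpCounts b u) (fromUpCounts b v)
↗⇒Move {b} (here {x} {y} {ys} x<y) (b≤x ∷ x≤y ∷ _) =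
  subst (Move _) merged (move (replicate (x ∸ b) U) (fromUpCounts y ys) (y ∸ x) (m<n⇒0<n∸m x<y))
  where
  gaps : (x ∸ b) + (y ∸ x) ≡ y ∸ b
  gaps = begin
    (x ∸ b) + (y ∸ x)  ≡⟨ +-comm (x ∸ b) (y ∸ x) ⟩
    (y ∸ x) + (x ∸ b)  ≡⟨ sym (+-∸-assoc (y ∸ x) b≤x) ⟩
    (y ∸ x) + x ∸ b    ≡⟨ cong (_∸ b) (m∸n+n≡m x≤y) ⟩
    y ∸ b              ∎
    where open ≡-Reasoning
  merged : replicate (x ∸ b) U ++ replicate (y ∸ x) U ++ D ∷ D ∷ fromUpCounts y ys
           ≡ fromUpCounts b (y ∷ y ∷ ys)
  merged rewrite n∸n≡0 y =
    trans (sym (replicate-+-++ (x ∸ b) (y ∸ x) U _)) (cong (λ i → replicate i U ++ D ∷ D ∷ fromUpCounts y ys) gaps)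
↗⇒Move {b} (there {z} r) (_ ∷ s) = Move-prefix (replicate (z ∸ b) U) (Move-prefix (D ∷ []) (↗⇒Move r s))

↗*⇒≤ₚ : ∀ {b u v} → u ↗* v → SortedFrom b u → fromUpCounts b u ≤ₚ fromUpCounts b v
↗*⇒≤ₚ ε        _ = ε
↗*⇒≤ₚ (r ◅ rs) s = ↗⇒Move r s ◅ ↗*⇒≤ₚ rs (↗-SortedFrom r s)

⊑⇒≤ₚ : ∀ k {h h′ p q} → DyckFrom h p → DyckFrom h′ q → upCounts k p ⊑ upCounts k q → p ≤ₚ q
⊑⇒≤ₚ k {p = p} {q} dp dq le =
  subst₂ _≤ₚ_ (fromUpCounts-upCounts 0 k dp z≤n) (fromUpCounts-upCounts 0 k dq z≤n)
    (↗*⇒≤ₚ (⊑⇒↗* (upCounts-sorted k p) (upCounts-sorted k q) le) (upCounts-sorted k p))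

-- Ascents and up-counts

psum-[] : ∀ j → psum j [] ≡ 0
psum-[] zero    = refl
psum-[] (suc j) = refl

psum-mono : ∀ {i j} cs → i ≤ j → psum i cs ≤ psum j cs
psum-mono {zero}          cs       _         = z≤n
psum-mono {suc i} {suc j} []       _         = z≤n
psum-mono {suc i} {suc j} (c ∷ cs) (s≤s i≤j) = +-monoʳ-≤ c (psum-mono cs i≤j)

c₁≡psum1 : ∀ p → c₁ p ≡ psum 1 (ascents p)
c₁≡psum1 p with ascents p
... | []    = refl
... | c ∷ _ = sym (+-identityʳ c)

upCounts-positive : ∀ {h k p} → DyckFrom h p → h ≤ k → All (0 <_) (upCounts k p)
upCounts-positive done     _   = []
upCounts-positive (up d)   h≤k = upCounts-positive d (s≤s h≤k)
upCounts-positive (down d) h<k = ≤-trans (s≤s z≤n) h<k ∷ upCounts-positive d (≤-trans (n≤1+n _) h<k)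

∈-upCounts⇒psum : ∀ c p {x} → x ∈ upCounts c p → ∃[ j ] x ≡ psum j (ascentsAux c p)
∈-upCounts⇒psum c       (U ∷ p) x∈          = ∈-upCounts⇒psum (suc c) p x∈
∈-upCounts⇒psum zero    (D ∷ p) (here refl) = 0 , refl
∈-upCounts⇒psum zero    (D ∷ p) (there x∈)  = ∈-upCounts⇒psum zero p x∈
∈-upCounts⇒psum (suc c) (D ∷ p) (here refl) = 1 , sym (+-identityʳ (suc c))
∈-upCounts⇒psum (suc c) (D ∷ p) (there x∈)
  with ∈-map⁻ (_+ suc c) (subst (_ ∈_) (upCounts-+ (suc c) 0 p) x∈)
... | x′ , x′∈ , refl with ∈-upCounts⇒psum 0 p x′∈
...   | j , refl = suc j , +-comm (psum j (ascentsAux 0 p)) (suc c)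

psum∈upCounts : ∀ c {h s p j} → DyckFrom h (s ∷ p) → 1 ≤ j → psum j (ascentsAux c (s ∷ p)) ∈ upCounts c (s ∷ p)
psum∈upCounts c       {p = []}    (up ())
psum∈upCounts c       {p = _ ∷ _} (up d)   j≥1 = psum∈upCounts (suc c) d j≥1
psum∈upCounts zero    {p = []}    {suc j} (down d) _ = here refl
psum∈upCounts (suc c) {p = []}    {suc j} (down d) _ =
  here (trans (cong (suc c +_) (psum-[] j)) (+-identityʳ (suc c)))
psum∈upCounts zero    {p = _ ∷ _} (down d) j≥1 = there (psum∈upCounts zero d j≥1)
psum∈upCounts (suc c) {p = _ ∷ _} {1} (down d) _ = here (+-identityʳ (suc c))
psum∈upCounts (suc c) {p = p@(_ ∷ _)} {suc (suc j)} (down d) _ =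
  there (subst₂ _∈_ (+-comm (psum (suc j) (ascentsAux 0 p)) (suc c)) (sym (upCounts-+ (suc c) 0 p))
          (∈-map⁺ (_+ suc c) (psum∈upCounts zero d (s≤s z≤n))))

peak-condition⇔ : ∀ {P r a b} → DyckFrom 0 P → 1 ≤ r → a ≤ c₁ P → b ≤ psum r (ascents P) →
  (b ≡ a ⊎ b ∈ upCounts 0 P)
  ⇔ ((∃[ j ] (1 ≤ j × j ≤ r × psum j (ascents P) ≡ b)) ⊎ (a ≡ b × a < c₁ P))
peak-condition⇔ {[]} {r} {a} {b} done r≥1 a≤ b≤ =
  mk⇔ (λ _ → inj₁ (1 , ≤-refl , r≥1 , sym b≡0)) (λ _ → inj₁ (trans b≡0 (sym (n≤0⇒n≡0 a≤))))
  where
  b≡0 : b ≡ 0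
  b≡0 = n≤0⇒n≡0 (subst (b ≤_) (psum-[] r) b≤)
peak-condition⇔ {P@(_ ∷ _)} {r} {a} {b} dP r≥1 a≤ b≤ = mk⇔ to from
  where
  to : b ≡ a ⊎ b ∈ upCounts 0 P → (∃[ j ] (1 ≤ j × j ≤ r × psum j (ascents P) ≡ b)) ⊎ (a ≡ b × a < c₁ P)
  to (inj₁ refl) with m≤n⇒m<n∨m≡n a≤
  ... | inj₁ a<c₁ = inj₂ (refl , a<c₁)
  ... | inj₂ refl = inj₁ (1 , ≤-refl , r≥1 , sym (c₁≡psum1 P))
  to (inj₂ b∈) with ∈-upCounts⇒psum 0 P b∈
  ... | zero  , refl = ⊥-elim (<-irrefl refl (All.lookup (upCounts-positive dP z≤n) b∈))
  ... | suc j , refl with suc j ≤? r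
  ...   | yes j≤r = inj₁ (suc j , s≤s z≤n , j≤r , refl)
  ...   | no  j≰r = inj₁ (r , r≥1 , ≤-refl , ≤-antisym (psum-mono (ascents P) (<⇒≤ (≰⇒> j≰r))) b≤)
  from : (∃[ j ] (1 ≤ j × j ≤ r × psum j (ascents P) ≡ b)) ⊎ (a ≡ b × a < c₁ P) → b ≡ a ⊎ b ∈ upCounts 0 P
  from (inj₁ (j , j≥1 , _ , refl)) = inj₂ (psum∈upCounts 0 dP j≥1)
  from (inj₂ (refl , _))           = inj₁ refl

-- Deleting and inserting the first large peak

deletion : ∀ m n {P′ Q′} → D' (suc m) (suc n) P′ → D' (suc m) (suc n) Q′ → P′ ≤ₚ Q′ →
           D' (suc m) n (deletePeak (suc m) P′) × D' (suc m) n (deletePeak (suc m) Q′)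
           × deletePeak (suc m) P′ ≤ₚ deletePeak (suc m) Q′
deletion m n dP dQ P′≤Q′ with withPeak-view dP | withPeak-view dQ
... | e , Y , refl | f , Z , refl
  rewrite deletePeak-withPeak m e Y (proj₁ (proj₁ dP)) | deletePeak-withPeak m f Z (proj₁ (proj₁ dQ)) =
  dP⁻ , dQ⁻ , ⊑⇒≤ₚ 0 (proj₁ (proj₁ dP⁻)) (proj₁ (proj₁ dQ⁻))
                 (proj₂ (Equivalence.to (peak-⊑⇔ m) (subst₂ _⊑_ (upCounts-withPeak (suc m) e 0 Y)
                                                              (upCounts-withPeak (suc m) f 0 Z)
                                                              (≤ₚ⇒⊑ 0 P′≤Q′))))
  where
  dP⁻ : D' (suc m) n (replicate e U ++ Y)
  dP⁻ = D'-withPeak⁻ (suc m) n e Y dP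
  dQ⁻ : D' (suc m) n (replicate f U ++ Z)
  dQ⁻ = D'-withPeak⁻ (suc m) n f Z dQ

insertion : ∀ m {P Q a b} → DyckFrom 0 P → DyckFrom 0 Q → P ≤ₚ Q → a ≤ c₁ P → b ≤ c₁ Q →
            insertPeak (suc m) a P ≤ₚ insertPeak (suc m) b Q ⇔ (b ≡ a ⊎ b ∈ upCounts 0 P)
insertion m {P} {Q} {a} {b} dP dQ P≤Q a≤ b≤ = mk⇔
  (λ ins≤ → proj₁ (Equivalence.to (peak-⊑⇔ m) (subst₂ _⊑_ upCountsP upCountsQ (≤ₚ⇒⊑ 0 ins≤))))
  (λ cond → ⊑⇒≤ₚ 0 (DyckFrom-insertPeak (suc m) a≤leadU dP) (DyckFrom-insertPeak (suc m) b≤leadU dQ)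
              (subst₂ _⊑_ (sym upCountsP) (sym upCountsQ)
                 (Equivalence.from (peak-⊑⇔ m) (cond , ≤ₚ⇒⊑ 0 P≤Q))))
  where
  a≤leadU : a ≤ leadU P
  a≤leadU = subst (a ≤_) (c₁≡leadU dP) a≤
  b≤leadU : b ≤ leadU Q
  b≤leadU = subst (b ≤_) (c₁≡leadU dQ) b≤
  upCountsP : upCounts 0 (insertPeak (suc m) a P) ≡ replicate (suc m) (a + suc m) ++ map (_+ suc m) (upCounts 0 P)
  upCountsP = upCounts-insertPeak (suc m) a P a≤leadU
  upCountsQ : upCounts 0 (insertPeak (suc m) b Q) ≡ replicate (suc m) (b + suc m) ++ map (_+ suc m) (upCounts 0 Q)
  upCountsQ = upCounts-insertPeak (suc m) b Q b≤leadU

lemma4p4 : ∀ (m n : ℕ) → 1 ≤ m →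
    ((P' Q' : Path) → D' m (suc n) P' → D' m (suc n) Q' → P' ≤ₚ Q' →
        D' m n (deletePeak m P') × D' m n (deletePeak m Q')
          × deletePeak m P' ≤ₚ deletePeak m Q')
    × ((P Q : Path) → D' m n P → D' m n Q → P ≤ₚ Q →
        (r : ℕ) → 1 ≤ r → psum r (ascents P) ≡ c₁ Q →
        (a b : ℕ) → a ≤ c₁ P → b ≤ c₁ Q →
        (insertPeak m a P ≤ₚ insertPeak m b Q
          ⇔ ((∃[ j ] (1 ≤ j × j ≤ r × psum j (ascents P) ≡ b))
             ⊎ (a ≡ b × a < c₁ P))))
lemma4p4 zero    n ()
lemma4p4 (suc m) n _ =
    (λ P′ Q′ → deletion m n)
  , λ P Q ((dP , _) , _) ((dQ , _) , _) P≤Q r r≥1 psum≡c₁ a b a≤ b≤ →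
      ⇔-trans (insertion m dP dQ P≤Q a≤ b≤) (peak-condition⇔ dP r≥1 a≤ (subst (b ≤_) (sym psum≡c₁) b≤))
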